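{- Let $V\subset\mathbb{Z}^n$ be finite with $0\in V$, and let $\mathcal{L}\subset\mathbb{Z}^n$ be such that $\{V+l : l\in\mathcal{L}\}$ is a tiling of $\mathbb{Z}^n$ by translates of $V$. Let $T:\mathbb{Z}[x_1^{\pm1},\dots,x_n^{\pm1}]\to\mathbb{Z}$ be the $\mathbb{Z}$-linear map with $T(x_1^{a_1}\cdots x_n^{a_n})=1$ if $(a_1,\dots,a_n)\in\mathcal{L}$ and $0$ otherwise, and let $Q_V=\sum_{(a_1,\dots,a_n)\in -V}x_1^{a_1}\cdots x_n^{a_n}$. Let $a$ be an integer relatively prime to $|V|$. Then for every Laurent polynomial $P\in\mathbb{Z}[x_1^{\pm1},\dots,x_n^{\pm1}]$, \[T\big(P\cdot Q_V(x_1^a,\dots,x_n^a)\big)=P(1,\dots,1).\]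
   Context: A tiling of $\mathbb{Z}^n$ by translates of $V$ is a family $\{V+l: l\in\mathcal{L}\}$ such that every $x\in\mathbb{Z}^n$ can be written uniquely as $x=v+l$ with $v\in V$, $l\in\mathcal{L}$. -}

module Defs where

open import Data.Nat using (ℕ)
open import Data.Integer as ℤ using (ℤ; 0ℤ; 1ℤ; _+_; _*_; -_)
open import Data.Vec using (Vec; zipWith; map; replicate)
open import Data.List as List using (List; []; _∷_; concatMap; length)
open import Data.Product using (_×_; _,_; ∃-syntax)
open import Data.List.Membership.Propositional using (_∈_)
open import Data.List.Relation.Unary.Unique.Propositional using (Unique)
open import Relation.Nullary using (Dec; yes; no)
open import Relation.Binary.PropositionalEquality using (_≡_)

-- Points of ℤⁿ, also used as exponent vectors of Laurent monomials.
Pt : ℕ → Set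
Pt n = Vec ℤ n

_⊕_ : ∀ {n} → Pt n → Pt n → Pt n
_⊕_ = zipWith _+_

⊖_ : ∀ {n} → Pt n → Pt n
⊖ v = map -_ v

scale : ∀ {n} → ℤ → Pt n → Pt n
scale a v = map (a *_) v

zeroPt : ∀ {n} → Pt n
zeroPt = replicate _ 0ℤ

-- A finite subset of ℤⁿ: a duplicate-free list; its cardinality is its length.
record FinSet (n : ℕ) : Set where
  constructor finset
  field
    elems  : List (Pt n)
    unique : Unique elems

open FinSet public

card : ∀ {n} → FinSet n → ℕ
card V = length (elems V)

IsTiling : ∀ {n} → FinSet n → (Pt n → Set) → Set
IsTiling {n} V L =
  (∀ (x : Pt n) → ∃[ v ] ∃[ l ] (v ∈ elems V × L l × x ≡ v ⊕ l))
  × (∀ (v v' l l' : Pt n) → v ∈ elems V → v' ∈ elems V → L l → L l' →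
       v ⊕ l ≡ v' ⊕ l' → (v ≡ v' × l ≡ l'))

-- Laurent polynomials in ℤ[x₁^{±1},…,xₙ^{±1}], written as finite formal sums
-- Σ cᵢ x^{eᵢ} (list of (coefficient, exponent vector) terms).
Laurent : ℕ → Set
Laurent n = List (ℤ × Pt n)

_·_ : ∀ {n} → Laurent n → Laurent n → Laurent n
P · Q = concatMap (λ { (c , e) → List.map (λ { (d , f) → (c * d , e ⊕ f) }) Q }) P

substPow : ∀ {n} → ℤ → Laurent n → Laurent n
substPow a P = List.map (λ { (c , e) → (c , scale a e) }) P

Q : ∀ {n} → FinSet n → Laurent n
Q V = List.map (λ v → (1ℤ , ⊖ v)) (elems V)

evalOne : ∀ {n} → Laurent n → ℤ
evalOne [] = 0ℤ
evalOne ((c , _) ∷ P) = c + evalOne P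

T : ∀ {n} {L : Pt n → Set} → (∀ x → Dec (L x)) → Laurent n → ℤ
T L? [] = 0ℤ
T L? ((c , e) ∷ P) with L? e
... | yes _ = c + T L? P
... | no  _ = T L? P

-- Write 𝟙 for the indicator function of L and (W ⋆ f)(x) = Σ_{w ∈ W} f(x − w). Expanding the product
-- monomial by monomial gives T(P · Q_V(x^a)) = Σ_e c_e · (aV ⋆ 𝟙)(e), so the identity amounts to
-- aV ⋆ 𝟙 ≡ 1, i.e. to aV tiling ℤⁿ with the same set of translations L (Tijdeman's theorem).
-- For a prime p ∤ |V|, the binomial theorem in the group semiring ℕ[ℤⁿ] gives the Frobenius
-- congruence V^p ≡ pV (mod p); as V^p ⋆ 𝟙 ≡ |V|^(p−1) is prime to p, pV covers every point.
-- Since Σ_{b ∈ V} (pV ⋆ 𝟙)(x − b) = |V| for every x, it then covers every point exactly once.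
-- Scaling by −1 covers every point at most once, by uniqueness in the tiling by V, and the same
-- count applies. Every a prime to |V| is a product of −1 and such primes, except a = 0, which
-- forces V = {0}.

module Submission where

open import Defs
open import Data.Nat using (ℕ)
open import Data.Integer using (ℤ; ∣_∣)
open import Data.Nat.Coprimality using (Coprime)
open import Data.List.Membership.Propositional using (_∈_)
open import Relation.Nullary using (Dec)
open import Relation.Binary.PropositionalEquality using (_≡_)

module Points where

  open import Data.Nat using (ℕ; zero; suc)
  open import Data.Integer using (ℤ; +_; 0ℤ; 1ℤ; -1ℤ; _+_; _*_; -_; ≢-nonZero)
  open import Data.Integer.Properties using (*-cancelˡ-≡; *-zeroʳ; *-identityˡ; *-assoc; +-identityʳ)
  open import Data.Integer.Tactic.RingSolver using (solve-∀)
  open import Data.Vec using ([]; _∷_; head; tail)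
  open import Data.List using (List; map)
  open import Data.List.Properties using (map-∘; map-cong; map-id)
  open import Relation.Nullary using (¬_)
  open import Relation.Binary.PropositionalEquality

  infixl 6 _⊝_
  _⊝_ : ∀ {n} → Pt n → Pt n → Pt n
  x ⊝ y = x ⊕ (⊖ y)

  ⊝-⊝ : ∀ {n} (y u w : Pt n) → y ⊝ u ⊝ w ≡ y ⊝ (u ⊕ w)
  ⊝-⊝ [] [] [] = refl
  ⊝-⊝ (y ∷ ys) (u ∷ us) (w ∷ ws) = cong₂ _∷_ (identity y u w) (⊝-⊝ ys us ws)
    where identity : ∀ y u w → y + - u + - w ≡ y + - (u + w)
          identity = solve-∀

  ⊝-comm : ∀ {n} (y u w : Pt n) → y ⊝ u ⊝ w ≡ y ⊝ w ⊝ u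
  ⊝-comm [] [] [] = refl
  ⊝-comm (y ∷ ys) (u ∷ us) (w ∷ ws) = cong₂ _∷_ (identity y u w) (⊝-comm ys us ws)
    where identity : ∀ y u w → y + - u + - w ≡ y + - w + - u
          identity = solve-∀

  ⊝-zeroʳ : ∀ {n} (y : Pt n) → y ⊝ zeroPt ≡ y
  ⊝-zeroʳ [] = refl
  ⊝-zeroʳ (y ∷ ys) = cong₂ _∷_ (+-identityʳ y) (⊝-zeroʳ ys)

  [v⊕l]⊝v≡l : ∀ {n} (v l : Pt n) → v ⊕ l ⊝ v ≡ l
  [v⊕l]⊝v≡l [] [] = refl
  [v⊕l]⊝v≡l (v ∷ vs) (l ∷ ls) = cong₂ _∷_ (identity v l) ([v⊕l]⊝v≡l vs ls)
    where identity : ∀ v l → v + l + - v ≡ l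
          identity = solve-∀

  v⊕[x⊝v]≡x : ∀ {n} (v x : Pt n) → v ⊕ (x ⊝ v) ≡ x
  v⊕[x⊝v]≡x [] [] = refl
  v⊕[x⊝v]≡x (v ∷ vs) (x ∷ xs) = cong₂ _∷_ (identity v x) (v⊕[x⊝v]≡x vs xs)
    where identity : ∀ v x → v + (x + - v) ≡ x
          identity = solve-∀

  [y⊝-a]⊝a≡y : ∀ {n} (y a : Pt n) → y ⊝ scale -1ℤ a ⊝ a ≡ y
  [y⊝-a]⊝a≡y [] [] = refl
  [y⊝-a]⊝a≡y (y ∷ ys) (a ∷ as) = cong₂ _∷_ (identity y a) ([y⊝-a]⊝a≡y ys as)
    where identity : ∀ y a → y + - (-1ℤ * a) + - a ≡ y
          identity = solve-∀

  scale-scale : ∀ {n} (s t : ℤ) (v : Pt n) → scale s (scale t v) ≡ scale (s * t) v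
  scale-scale s t [] = refl
  scale-scale s t (v ∷ vs) = cong₂ _∷_ (sym (*-assoc s t v)) (scale-scale s t vs)

  scale-one : ∀ {n} (v : Pt n) → scale 1ℤ v ≡ v
  scale-one [] = refl
  scale-one (v ∷ vs) = cong₂ _∷_ (*-identityˡ v) (scale-one vs)

  scale-zero : ∀ {n} (v : Pt n) → scale 0ℤ v ≡ zeroPt
  scale-zero [] = refl
  scale-zero (v ∷ vs) = cong (0ℤ ∷_) (scale-zero vs)

  scale-zeroPt : ∀ {n} (t : ℤ) → scale t (zeroPt {n}) ≡ zeroPt
  scale-zeroPt {zero} t = refl
  scale-zeroPt {suc n} t = cong₂ _∷_ (*-zeroʳ t) (scale-zeroPt t)

  scale-⊖ : ∀ {n} (t : ℤ) (v : Pt n) → scale t (⊖ v) ≡ ⊖ scale t v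
  scale-⊖ t [] = refl
  scale-⊖ t (v ∷ vs) = cong₂ _∷_ (identity t v) (scale-⊖ t vs)
    where identity : ∀ t v → t * - v ≡ - (t * v)
          identity = solve-∀

  scale-suc : ∀ {n} (k : ℕ) (v : Pt n) → v ⊕ scale (+ k) v ≡ scale (+ suc k) v
  scale-suc k [] = refl
  scale-suc k (v ∷ vs) = cong₂ _∷_ (identity (+ k) v) (scale-suc k vs)
    where identity : ∀ k v → v + k * v ≡ (1ℤ + k) * v
          identity = solve-∀

  scale-injective : ∀ {n} (t : ℤ) → ¬ t ≡ 0ℤ → {v w : Pt n} → scale t v ≡ scale t w → v ≡ w
  scale-injective t t≢0 {[]} {[]} _ = refl
  scale-injective t t≢0 {v ∷ vs} {w ∷ ws} eq =
    cong₂ _∷_ (*-cancelˡ-≡ t v w {{≢-nonZero t≢0}} (cong head eq))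
              (scale-injective t t≢0 (cong tail eq))

  map-scale-scale : ∀ {n} s t (W : List (Pt n)) → map (scale s) (map (scale t) W) ≡ map (scale (s * t)) W
  map-scale-scale s t W = trans (sym (map-∘ W)) (map-cong (scale-scale s t) W)

  map-scale-one : ∀ {n} (W : List (Pt n)) → map (scale 1ℤ) W ≡ W
  map-scale-one W = trans (map-cong scale-one W) (map-id W)

module ModPrime where

  open import Data.Nat
  open import Data.Nat.Properties
  open import Data.Nat.Divisibility
  open import Data.Nat.Primality using (Prime; euclidsLemma; ¬prime[1])
  open import Data.Nat.Combinatorics using (_C_; nC1≡n; nCn≡1; k>n⇒nCk≡0; nCk+nC[k+1]≡[n+1]C[k+1])
  open import Data.Nat.Tactic.RingSolver using (solve-∀)
  open import Data.Fin as Fin using (Fin; toℕ; fromℕ; inject₁)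
  open import Data.Fin.Properties using (toℕ-inject₁; toℕ-fromℕ; toℕ<n)
  open import Function using (_∘_)
  open import Algebra.Properties.Monoid.Sum +-0-monoid using (sum; sum-init-last)
  open import Data.Product using (∃-syntax; _,_)
  open import Data.Sum using (inj₁; inj₂)
  open import Relation.Nullary using (contradiction)
  open import Relation.Binary.PropositionalEquality
  open ≡-Reasoning

  [k+1]*[n+1]C[k+1]≡[n+1]*nCk : ∀ n k → suc k * (suc n C suc k) ≡ suc n * (n C k)
  [k+1]*[n+1]C[k+1]≡[n+1]*nCk zero zero = refl
  [k+1]*[n+1]C[k+1]≡[n+1]*nCk zero (suc k) = begin
    suc (suc k) * (1 C suc (suc k)) ≡⟨ cong (suc (suc k) *_) (k>n⇒nCk≡0 {1} {suc (suc k)} (s<s z<s)) ⟩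
    suc (suc k) * 0                 ≡⟨ *-zeroʳ (suc (suc k)) ⟩
    0                               ≡⟨ cong (1 *_) (k>n⇒nCk≡0 {0} {suc k} z<s) ⟨
    1 * (0 C suc k)                 ∎
  [k+1]*[n+1]C[k+1]≡[n+1]*nCk (suc n) zero =
    trans (*-identityˡ _) (trans (nC1≡n (suc (suc n))) (sym (*-identityʳ (suc (suc n)))))
  [k+1]*[n+1]C[k+1]≡[n+1]*nCk (suc n) (suc k) = begin
    suc (suc k) * (suc (suc n) C suc (suc k))
      ≡⟨ cong (suc (suc k) *_) (nCk+nC[k+1]≡[n+1]C[k+1] (suc n) (suc k)) ⟨
    suc (suc k) * (A + B)
      ≡⟨ distribute A B k ⟩
    A + suc k * A + suc (suc k) * B
      ≡⟨ cong₂ (λ x y → A + x + y) ([k+1]*[n+1]C[k+1]≡[n+1]*nCk n k)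
                                   ([k+1]*[n+1]C[k+1]≡[n+1]*nCk n (suc k)) ⟩
    A + suc n * (n C k) + suc n * (n C suc k)
      ≡⟨ collect A (suc n) (n C k) (n C suc k) ⟩
    A + suc n * (n C k + n C suc k)
      ≡⟨ cong (λ x → A + suc n * x) (nCk+nC[k+1]≡[n+1]C[k+1] n k) ⟩
    suc (suc n) * A
      ∎
    where
      A = suc n C suc k
      B = suc n C suc (suc k)
      distribute : ∀ a b k → suc (suc k) * (a + b) ≡ a + suc k * a + suc (suc k) * b
      distribute = solve-∀
      collect : ∀ a m x y → a + m * x + m * y ≡ a + m * (x + y)
      collect = solve-∀

  prime∣pCk : ∀ {p k} → Prime p → 0 < k → k < p → p ∣ p C k
  prime∣pCk {suc q} {suc j} pr _ j<q with euclidsLemma (suc j) (suc q C suc j) pr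
    (divides (q C j) (trans ([k+1]*[n+1]C[k+1]≡[n+1]*nCk q j) (*-comm (suc q) (q C j))))
  ... | inj₁ p∣k = contradiction (∣⇒≤ p∣k) (<⇒≱ j<q)
  ... | inj₂ p∣C = p∣C

  prime∤⇒∤^ : ∀ {p m} → Prime p → p ∤ m → ∀ k → p ∤ m ^ k
  prime∤⇒∤^ pr p∤m zero p∣1 = ¬prime[1] (subst Prime (∣1⇒≡1 p∣1) pr)
  prime∤⇒∤^ {m = m} pr p∤m (suc k) p∣m^[1+k] with euclidsLemma m (m ^ k) pr p∣m^[1+k]
  ... | inj₁ p∣m   = p∤m p∣m
  ... | inj₂ p∣m^k = prime∤⇒∤^ pr p∤m k p∣m^k

  ∣-sum : ∀ {m d} (t : Fin m → ℕ) → (∀ i → d ∣ t i) → d ∣ sum t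
  ∣-sum {zero} {d} t _ = d ∣0
  ∣-sum {suc m} t d∣t = ∣m∣n⇒∣m+n (d∣t Fin.zero) (∣-sum (t ∘ Fin.suc) (d∣t ∘ Fin.suc))

  binomialSum-modPrime : ∀ {p} → Prime p → (t : Fin (suc p) → ℕ) →
    ∃[ m ] sum (λ i → (p C toℕ i) * t i) ≡ t Fin.zero + t (fromℕ p) + p * m
  binomialSum-modPrime {suc q} pr t = result (∣-sum middle middle-divisible)
    where
      middle : Fin q → ℕ
      middle i = (suc q C suc (toℕ (inject₁ i))) * t (Fin.suc (inject₁ i))
      middle-divisible : ∀ i → suc q ∣ middle i
      middle-divisible i = ∣m⇒∣m*n (t (Fin.suc (inject₁ i)))
        (prime∣pCk pr z<s (s<s (subst (_< q) (sym (toℕ-inject₁ i)) (toℕ<n i))))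
      last≡ : (suc q C suc (toℕ (fromℕ q))) * t (fromℕ (suc q)) ≡ t (fromℕ (suc q))
      last≡ = trans (cong (λ k → (suc q C suc k) * t (fromℕ (suc q))) (toℕ-fromℕ q))
                    (trans (cong (_* t (fromℕ (suc q))) (nCn≡1 (suc q))) (*-identityˡ _))
      rearrange : ∀ a m p b → a + (m * p + b) ≡ a + b + p * m
      rearrange = solve-∀
      result : suc q ∣ sum middle →
        ∃[ m ] sum (λ i → (suc q C toℕ i) * t i) ≡ t Fin.zero + t (fromℕ (suc q)) + suc q * m
      result (divides m middle≡m*p) = m , (begin
        sum (λ i → (suc q C toℕ i) * t i)
          ≡⟨ cong₂ _+_ (*-identityˡ (t Fin.zero))
                       (sum-init-last (λ i → (suc q C toℕ (Fin.suc i)) * t (Fin.suc i))) ⟩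
        t Fin.zero + (sum middle + (suc q C suc (toℕ (fromℕ q))) * t (fromℕ (suc q)))
          ≡⟨ cong₂ (λ x y → t Fin.zero + (x + y)) middle≡m*p last≡ ⟩
        t Fin.zero + (m * suc q + t (fromℕ (suc q)))
          ≡⟨ rearrange (t Fin.zero) m (suc q) (t (fromℕ (suc q))) ⟩
        t Fin.zero + t (fromℕ (suc q)) + suc q * m ∎)

module ListSums {A : Set} where

  open import Data.Nat
  open import Data.Nat.Properties
  open import Data.Nat.ListAction using (sum)
  open import Data.List using (List; []; _∷_; map; length)
  open import Data.List.Membership.Propositional using (_∈_)
  open import Data.List.Relation.Unary.Any using (here; there)
  open import Data.List.Relation.Unary.All using (lookup)
  open import Data.List.Relation.Unary.Unique.Propositional using (Unique; []; _∷_)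
  open import Data.Product using (_×_; _,_; proj₁; proj₂)
  open import Data.Empty using (⊥; ⊥-elim)
  open import Relation.Nullary using (¬_; yes; no; contradiction)
  open import Function using (_∘_)
  open import Relation.Binary.PropositionalEquality

  +-mono-≤-≡ : ∀ {a b c d} → a ≤ b → c ≤ d → a + c ≡ b + d → a ≡ b × c ≡ d
  +-mono-≤-≡ {a} {b} {c} {d} a≤b c≤d eq =
    a≡b , +-cancelˡ-≡ a c d (trans eq (cong (_+ d) (sym a≡b)))
    where
      a≡b : a ≡ b
      a≡b = ≤-antisym a≤b (+-cancelʳ-≤ d b a (≤-trans (≤-reflexive (sym eq)) (+-monoʳ-≤ a c≤d)))

  sum-map-const : ∀ c (as : List A) → sum (map (λ _ → c) as) ≡ length as * c
  sum-map-const c [] = refl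
  sum-map-const c (a ∷ as) = cong (c +_) (sum-map-const c as)

  sum-map-mono-≤ : ∀ {g h : A → ℕ} as → (∀ {a} → a ∈ as → g a ≤ h a) →
    sum (map g as) ≤ sum (map h as)
  sum-map-mono-≤ [] g≤h = z≤n
  sum-map-mono-≤ (a ∷ as) g≤h = +-mono-≤ (g≤h (here refl)) (sum-map-mono-≤ as (g≤h ∘ there))

  sum-map-≡⇒≡ : ∀ {g h : A → ℕ} as → (∀ {a} → a ∈ as → g a ≤ h a) →
    sum (map g as) ≡ sum (map h as) → ∀ {a} → a ∈ as → g a ≡ h a
  sum-map-≡⇒≡ (a ∷ as) g≤h eq (here refl) =
    proj₁ (+-mono-≤-≡ (g≤h (here refl)) (sum-map-mono-≤ as (g≤h ∘ there)) eq)
  sum-map-≡⇒≡ (a ∷ as) g≤h eq (there b∈as) =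
    sum-map-≡⇒≡ as (g≤h ∘ there)
      (proj₂ (+-mono-≤-≡ (g≤h (here refl)) (sum-map-mono-≤ as (g≤h ∘ there)) eq)) b∈as

  ∈⇒≤sum-map : ∀ (h : A → ℕ) {as a} → a ∈ as → h a ≤ sum (map h as)
  ∈⇒≤sum-map h {b ∷ as} (here refl) = m≤m+n (h b) _
  ∈⇒≤sum-map h {b ∷ as} (there a∈as) = ≤-trans (∈⇒≤sum-map h a∈as) (m≤n+m _ (h b))

  2≤sum-map : ∀ (h : A → ℕ) {as a a′} → a ∈ as → a′ ∈ as → ¬ a ≡ a′ →
    1 ≤ h a → 1 ≤ h a′ → 2 ≤ sum (map h as)
  2≤sum-map h (here refl) (here refl) a≢a′ _ _ = contradiction refl a≢a′
  2≤sum-map h (here refl) (there a′∈as) _ 1≤ha 1≤ha′ =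
    +-mono-≤ 1≤ha (≤-trans 1≤ha′ (∈⇒≤sum-map h a′∈as))
  2≤sum-map h (there a∈as) (here refl) _ 1≤ha 1≤ha′ =
    +-mono-≤ 1≤ha′ (≤-trans 1≤ha (∈⇒≤sum-map h a∈as))
  2≤sum-map h {b ∷ as} (there a∈as) (there a′∈as) a≢a′ 1≤ha 1≤ha′ =
    ≤-trans (2≤sum-map h a∈as a′∈as a≢a′ 1≤ha 1≤ha′) (m≤n+m _ (h b))

  sum-map≤1 : ∀ (h : A → ℕ) {as} → Unique as → (∀ a → h a ≤ 1) →
    (∀ {a a′} → a ∈ as → a′ ∈ as → ¬ a ≡ a′ → 1 ≤ h a → 1 ≤ h a′ → ⊥) →
    sum (map h as) ≤ 1
  sum-map≤1 h [] _ _ = z≤n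
  sum-map≤1 h {b ∷ as} (b∉as ∷ unique) h≤1 atMostOne with 1 ≤? h b
  ... | no  1≰hb = +-mono-≤ (s≤s⁻¹ (≰⇒> 1≰hb))
                            (sum-map≤1 h unique h≤1 (λ a∈ a′∈ → atMostOne (there a∈) (there a′∈)))
  ... | yes 1≤hb = +-mono-≤ (h≤1 b) (begin
    sum (map h as)            ≤⟨ sum-map-mono-≤ {h = λ _ → 0} as rest≤0 ⟩
    sum (map (λ _ → 0) as)    ≡⟨ sum-map-const 0 as ⟩
    length as * 0             ≡⟨ *-zeroʳ (length as) ⟩
    0                         ∎)
    where
      rest≤0 : ∀ {a} → a ∈ as → h a ≤ 0
      rest≤0 {a} a∈as with 1 ≤? h a
      ... | no  1≰ha = s≤s⁻¹ (≰⇒> 1≰ha)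
      ... | yes 1≤ha = ⊥-elim (atMostOne (here refl) (there a∈as) (lookup b∉as a∈as) 1≤hb 1≤ha)
      open ≤-Reasoning

module Convolution {n : ℕ} where
  open Points
  open ListSums using (sum-map-const)
  open import Data.Nat
  open import Data.Nat.Properties
  open import Data.Nat.ListAction using (sum)
  open import Data.List using (List; []; _∷_; _++_; map; concatMap; length)
  open import Data.List.Properties using (map-++; map-cong; ++-assoc; ++-identityʳ)
  open import Data.Nat.ListAction.Properties using (sum-++)
  open import Algebra.Properties.CommutativeSemigroup +-commutativeSemigroup using (interchange)
  open import Algebra.Bundles using (CommutativeSemiring)
  open import Algebra.Structures.Biased using (isCommutativeSemiringˡ)
  open import Function using (const)
  open import Level using (0ℓ)
  open import Relation.Binary.PropositionalEquality

  infixr 5 _⋆_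
  infixl 7 _⊛_

  _⋆_ : List (Pt n) → (Pt n → ℕ) → Pt n → ℕ
  (U ⋆ f) y = sum (map (λ u → f (y ⊝ u)) U)

  _⊛_ : List (Pt n) → List (Pt n) → List (Pt n)
  U ⊛ V = concatMap (λ u → map (u ⊕_) V) U

  ⋆-++ : ∀ U V f y → ((U ++ V) ⋆ f) y ≡ (U ⋆ f) y + (V ⋆ f) y
  ⋆-++ U V f y = trans (cong sum (map-++ _ U V)) (sum-++ (map _ U) (map _ V))

  ⋆-congʳ : ∀ U {f g} → (∀ z → f z ≡ g z) → ∀ y → (U ⋆ f) y ≡ (U ⋆ g) y
  ⋆-congʳ U f≗g y = cong sum (map-cong (λ u → f≗g (y ⊝ u)) U)

  ⋆-+ : ∀ U f g y → (U ⋆ (λ z → f z + g z)) y ≡ (U ⋆ f) y + (U ⋆ g) y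
  ⋆-+ [] f g y = refl
  ⋆-+ (u ∷ U) f g y = trans (cong (f (y ⊝ u) + g (y ⊝ u) +_) (⋆-+ U f g y))
                             (interchange (f (y ⊝ u)) (g (y ⊝ u)) _ _)

  ⋆-const : ∀ U c y → (U ⋆ const c) y ≡ length U * c
  ⋆-const U c y = sum-map-const c U

  ⋆-shift : ∀ V u f y → (V ⋆ f) (y ⊝ u) ≡ (V ⋆ (λ z → f (z ⊝ u))) y
  ⋆-shift [] u f y = refl
  ⋆-shift (v ∷ V) u f y = cong₂ _+_ (cong f (⊝-comm y u v)) (⋆-shift V u f y)

  ⋆-comm : ∀ U V f y → (U ⋆ V ⋆ f) y ≡ (V ⋆ U ⋆ f) y
  ⋆-comm [] V f y = sym (trans (⋆-const V 0 y) (*-zeroʳ (length V)))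
  ⋆-comm (u ∷ U) V f y = trans (cong₂ _+_ (⋆-shift V u f y) (⋆-comm U V f y))
                                (sym (⋆-+ V (λ z → f (z ⊝ u)) (U ⋆ f) y))

  [0]⋆ : ∀ f y → ((zeroPt ∷ []) ⋆ f) y ≡ f y
  [0]⋆ f y = trans (+-identityʳ _) (cong f (⊝-zeroʳ y))

  ⋆-map-⊕ : ∀ u V f y → (map (u ⊕_) V ⋆ f) y ≡ (V ⋆ f) (y ⊝ u)
  ⋆-map-⊕ u [] f y = refl
  ⋆-map-⊕ u (v ∷ V) f y = cong₂ _+_ (cong f (sym (⊝-⊝ y u v))) (⋆-map-⊕ u V f y)

  ⊛-⋆ : ∀ U V f y → (U ⊛ V ⋆ f) y ≡ (U ⋆ V ⋆ f) y
  ⊛-⋆ [] V f y = refl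
  ⊛-⋆ (u ∷ U) V f y = trans (⋆-++ (map (u ⊕_) V) (U ⊛ V) f y)
                             (cong₂ _+_ (⋆-map-⊕ u V f y) (⊛-⋆ U V f y))

  _≈⋆_ : List (Pt n) → List (Pt n) → Set
  U ≈⋆ V = ∀ f y → (U ⋆ f) y ≡ (V ⋆ f) y

  -- The group semiring ℕ[ℤⁿ]: finite multisets of points, two of them being identified when
  -- they convolve every function alike.
  convolutionSemiring : CommutativeSemiring 0ℓ 0ℓ
  convolutionSemiring = record
    { Carrier = List (Pt n)
    ; _≈_ = _≈⋆_
    ; _+_ = _++_
    ; _*_ = _⊛_
    ; 0# = []
    ; 1# = zeroPt ∷ []
    ; isCommutativeSemiring = isCommutativeSemiringˡ record
      { +-isCommutativeMonoid = record
        { isMonoid = record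
          { isSemigroup = record
            { isMagma = record
              { isEquivalence = equivalence ; ∙-cong = λ {U U′ V V′} → ++-cong {U} {U′} {V} {V′} }
            ; assoc = λ U V W → ≡⇒≈⋆ (++-assoc U V W) }
          ; identity = (λ U f y → refl) , (λ U → ≡⇒≈⋆ (++-identityʳ U)) }
        ; comm = λ U V f y →
            trans (⋆-++ U V f y) (trans (+-comm ((U ⋆ f) y) ((V ⋆ f) y)) (sym (⋆-++ V U f y))) }
      ; *-isCommutativeMonoid = record
        { isMonoid = record
          { isSemigroup = record
            { isMagma = record
              { isEquivalence = equivalence ; ∙-cong = λ {U U′ V V′} → ⊛-cong {U} {U′} {V} {V′} }
            ; assoc = ⊛-assoc }
          ; identity = ⊛-identityˡ , ⊛-identityʳ }
        ; comm = λ U V f y → trans (⊛-⋆ U V f y) (trans (⋆-comm U V f y) (sym (⊛-⋆ V U f y))) }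
      ; distribʳ = ⊛-distribʳ
      ; zeroˡ = λ U f y → refl
      }
    }
    where
      open import Data.Product using (_,_)
      open import Relation.Binary.Structures using (IsEquivalence)
      equivalence : IsEquivalence _≈⋆_
      equivalence = record
        { refl  = λ f y → refl
        ; sym   = λ e f y → sym (e f y)
        ; trans = λ e e′ f y → trans (e f y) (e′ f y)
        }
      ≡⇒≈⋆ : ∀ {U V} → U ≡ V → U ≈⋆ V
      ≡⇒≈⋆ refl f y = refl
      ++-cong : ∀ {U U′ V V′} → U ≈⋆ U′ → V ≈⋆ V′ → (U ++ V) ≈⋆ (U′ ++ V′)
      ++-cong {U} {U′} {V} {V′} e e′ f y =
        trans (⋆-++ U V f y) (trans (cong₂ _+_ (e f y) (e′ f y)) (sym (⋆-++ U′ V′ f y)))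
      ⊛-cong : ∀ {U U′ V V′} → U ≈⋆ U′ → V ≈⋆ V′ → (U ⊛ V) ≈⋆ (U′ ⊛ V′)
      ⊛-cong {U} {U′} {V} {V′} e e′ f y =
        trans (⊛-⋆ U V f y)
          (trans (⋆-congʳ U (e′ f) y) (trans (e (V′ ⋆ f) y) (sym (⊛-⋆ U′ V′ f y))))
      ⊛-assoc : ∀ U V W → (U ⊛ V ⊛ W) ≈⋆ (U ⊛ (V ⊛ W))
      ⊛-assoc U V W f y = begin
        (U ⊛ V ⊛ W ⋆ f) y      ≡⟨ ⊛-⋆ (U ⊛ V) W f y ⟩
        (U ⊛ V ⋆ W ⋆ f) y      ≡⟨ ⊛-⋆ U V (W ⋆ f) y ⟩
        (U ⋆ V ⋆ W ⋆ f) y      ≡⟨ ⋆-congʳ U (λ z → ⊛-⋆ V W f z) y ⟨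
        (U ⋆ V ⊛ W ⋆ f) y      ≡⟨ ⊛-⋆ U (V ⊛ W) f y ⟨
        (U ⊛ (V ⊛ W) ⋆ f) y    ∎
        where open ≡-Reasoning
      ⊛-identityˡ : ∀ U → ((zeroPt ∷ []) ⊛ U) ≈⋆ U
      ⊛-identityˡ U f y = trans (⊛-⋆ (zeroPt ∷ []) U f y) ([0]⋆ (U ⋆ f) y)
      ⊛-identityʳ : ∀ U → (U ⊛ (zeroPt ∷ [])) ≈⋆ U
      ⊛-identityʳ U f y = trans (⊛-⋆ U (zeroPt ∷ []) f y) (⋆-congʳ U ([0]⋆ f) y)
      ⊛-distribʳ : ∀ U V W → ((V ++ W) ⊛ U) ≈⋆ (V ⊛ U ++ W ⊛ U)
      ⊛-distribʳ U V W f y = begin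
        ((V ++ W) ⊛ U ⋆ f) y               ≡⟨ ⊛-⋆ (V ++ W) U f y ⟩
        ((V ++ W) ⋆ U ⋆ f) y               ≡⟨ ⋆-++ V W (U ⋆ f) y ⟩
        (V ⋆ U ⋆ f) y + (W ⋆ U ⋆ f) y      ≡⟨ cong₂ _+_ (⊛-⋆ V U f y) (⊛-⋆ W U f y) ⟨
        (V ⊛ U ⋆ f) y + (W ⊛ U ⋆ f) y      ≡⟨ ⋆-++ (V ⊛ U) (W ⊛ U) f y ⟨
        ((V ⊛ U ++ W ⊛ U) ⋆ f) y           ∎
        where open ≡-Reasoning

module Frobenius {n : ℕ} where
  open Points
  open Convolution {n}
  open ModPrime using (binomialSum-modPrime)
  open import Data.Nat using (zero; suc; _+_; _*_; _∸_)
  open import Data.Nat.Properties using (*-zeroʳ; +-identityʳ; n∸n≡0)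
  open import Data.Nat.Primality using (Prime; ¬prime[0])
  open import Data.Nat.Combinatorics using (_C_)
  open import Data.Nat.Tactic.RingSolver using (solve-∀)
  open import Data.Integer using (+_)
  open import Data.Fin as Fin using (Fin; toℕ; fromℕ)
  open import Data.Fin.Properties using (toℕ-fromℕ)
  open import Data.List using (List; []; _∷_; map)
  open import Data.Product using (∃-syntax; _,_)
  open import Algebra.Bundles using (CommutativeSemiring)
  open import Algebra.Properties.Monoid.Sum Data.Nat.Properties.+-0-monoid using (sum; sum-cong-≗)
  open import Function using (_∘_)
  open import Relation.Binary.PropositionalEquality
  open import Relation.Nullary using (contradiction)
  open ≡-Reasoning

  open CommutativeSemiring convolutionSemiring using (semiring; +-rawMonoid)
  open import Algebra.Properties.Semiring.Exp semiring public using (_^_)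
  open import Algebra.Definitions.RawMonoid +-rawMonoid using () renaming (sum to ∑⋆; _×_ to _×⋆_)
  import Algebra.Properties.CommutativeSemiring.Binomial convolutionSemiring as Binomial

  ⋆-× : ∀ k U f y → (k ×⋆ U ⋆ f) y ≡ k * (U ⋆ f) y
  ⋆-× zero U f y = refl
  ⋆-× (suc k) U f y = trans (⋆-++ U (k ×⋆ U) f y) (cong (λ m → (U ⋆ f) y + m) (⋆-× k U f y))

  ⋆-∑ : ∀ {m} (g : Fin m → List (Pt n)) f y → (∑⋆ g ⋆ f) y ≡ sum (λ i → (g i ⋆ f) y)
  ⋆-∑ {zero} g f y = refl
  ⋆-∑ {suc m} g f y = trans (⋆-++ (g Fin.zero) (∑⋆ (g ∘ Fin.suc)) f y)
                              (cong (λ m → (g Fin.zero ⋆ f) y + m) (⋆-∑ (g ∘ Fin.suc) f y))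

  [u]^k⋆ : ∀ k u f y → ((u ∷ []) ^ k ⋆ f) y ≡ f (y ⊝ scale (+ k) u)
  [u]^k⋆ zero u f y = trans ([0]⋆ f y) (cong f (sym (trans (cong (y ⊝_) (scale-zero u)) (⊝-zeroʳ y))))
  [u]^k⋆ (suc k) u f y = begin
    ((u ∷ []) ⊛ (u ∷ []) ^ k ⋆ f) y      ≡⟨ ⊛-⋆ (u ∷ []) ((u ∷ []) ^ k) f y ⟩
    ((u ∷ []) ^ k ⋆ f) (y ⊝ u) + 0       ≡⟨ +-identityʳ _ ⟩
    ((u ∷ []) ^ k ⋆ f) (y ⊝ u)           ≡⟨ [u]^k⋆ k u f (y ⊝ u) ⟩
    f (y ⊝ u ⊝ scale (+ k) u)            ≡⟨ cong f (⊝-⊝ y u (scale (+ k) u)) ⟩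
    f (y ⊝ (u ⊕ scale (+ k) u))          ≡⟨ cong (λ v → f (y ⊝ v)) (scale-suc k u) ⟩
    f (y ⊝ scale (+ suc k) u)            ∎

  frobenius : ∀ {p} → Prime p → ∀ U f y →
    ∃[ m ] (U ^ p ⋆ f) y ≡ (map (scale (+ p)) U ⋆ f) y + p * m
  frobenius {zero} pr = contradiction pr ¬prime[0]
  frobenius {suc q} pr [] f y = 0 , sym (*-zeroʳ (suc q))
  -- u ∷ U is the semiring sum (u ∷ []) ++ U, to which the binomial theorem applies.
  frobenius {p@(suc q)} pr (u ∷ U) f y
    with frobenius pr U f y | binomialSum-modPrime pr (λ i → (Binomial.binomial (u ∷ []) U p i ⋆ f) y)
  ... | m′ , U^p≡ | m , expansion≡ = m′ + m , (begin
    ((u ∷ U) ^ p ⋆ f) y                          ≡⟨ Binomial.theorem p (u ∷ []) U f y ⟩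
    (Binomial.binomialExpansion [u] U p ⋆ f) y     ≡⟨ ⋆-∑ (Binomial.binomialTerm [u] U p) f y ⟩
    sum (λ i → (Binomial.binomialTerm [u] U p i ⋆ f) y)
        ≡⟨ sum-cong-≗ (λ i → ⋆-× (p C toℕ i) (Binomial.binomial [u] U p i) f y) ⟩
    sum (λ i → (p C toℕ i) * term i)             ≡⟨ expansion≡ ⟩
    term Fin.zero + term (fromℕ p) + p * m
        ≡⟨ cong₂ (λ a b → a + b + p * m) (trans first≡ U^p≡) last≡ ⟩
    (pU ⋆ f) y + p * m′ + f (y ⊝ scale (+ p) u) + p * m
        ≡⟨ rearrange ((pU ⋆ f) y) (f (y ⊝ scale (+ p) u)) p m′ m ⟩
    f (y ⊝ scale (+ p) u) + (pU ⋆ f) y + p * (m′ + m) ∎)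
    where
      [u] = u ∷ []
      term : Fin (suc p) → ℕ
      term i = (Binomial.binomial [u] U p i ⋆ f) y
      pU = map (scale (+ p)) U
      first≡ : term Fin.zero ≡ (U ^ p ⋆ f) y
      first≡ = trans (⊛-⋆ (zeroPt ∷ []) (U ^ p) f y) ([0]⋆ (U ^ p ⋆ f) y)
      last≡ : term (fromℕ p) ≡ f (y ⊝ scale (+ p) u)
      last≡ = begin
        term (fromℕ p)
            ≡⟨ ⊛-⋆ ([u] ^ toℕ (fromℕ p)) (U ^ (p ∸ toℕ (fromℕ p))) f y ⟩
        ([u] ^ toℕ (fromℕ p) ⋆ U ^ (p ∸ toℕ (fromℕ p)) ⋆ f) y
            ≡⟨ cong (λ k → ([u] ^ k ⋆ U ^ (p ∸ k) ⋆ f) y) (toℕ-fromℕ p) ⟩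
        ([u] ^ p ⋆ U ^ (p ∸ p) ⋆ f) y
            ≡⟨ cong (λ k → ([u] ^ p ⋆ U ^ k ⋆ f) y) (n∸n≡0 p) ⟩
        ([u] ^ p ⋆ (zeroPt ∷ []) ⋆ f) y                ≡⟨ ⋆-congʳ ([u] ^ p) ([0]⋆ f) y ⟩
        ([u] ^ p ⋆ f) y                                ≡⟨ [u]^k⋆ p u f y ⟩
        f (y ⊝ scale (+ p) u)                          ∎
      rearrange : ∀ a b p m′ m → a + p * m′ + b + p * m ≡ b + a + p * (m′ + m)
      rearrange = solve-∀

module Tiles {n : ℕ} {L : Pt n → Set} (L? : ∀ x → Dec (L x)) where
  open Points
  open ListSums using (sum-map≤1; ∈⇒≤sum-map; sum-map-≡⇒≡)
  open Convolution {n}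
  open import Data.Nat using (_*_; _≤_; z≤n; s≤s)
  open import Data.Nat.Properties using (≤-antisym; ≤-trans)
  open import Data.Bool using (if_then_else_)
  open import Data.Integer using (0ℤ)
  open import Data.List using (List; map; length)
  open import Data.List.Properties using (length-map)
  open import Data.List.Membership.Propositional.Properties using (∈-map⁺)
  open import Data.List.Relation.Unary.Unique.Propositional using (Unique)
  open import Data.List.Relation.Unary.Unique.Propositional.Properties using (map⁺)
  open import Data.Product using (_,_; proj₁)
  open import Data.Sum using (_⊎_; inj₁; inj₂)
  open import Function using (const)
  open import Relation.Nullary using (yes; no; does; ¬_; contradiction)
  open import Relation.Binary.PropositionalEquality

  𝟙 : Pt n → ℕ
  𝟙 z = if does (L? z) then 1 else 0

  𝟙≤1 : ∀ z → 𝟙 z ≤ 1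
  𝟙≤1 z with L? z
  ... | yes _ = s≤s z≤n
  ... | no  _ = z≤n

  L⇒1≤𝟙 : ∀ {z} → L z → 1 ≤ 𝟙 z
  L⇒1≤𝟙 {z} l with L? z
  ... | yes _ = s≤s z≤n
  ... | no ¬l = contradiction l ¬l

  1≤𝟙⇒L : ∀ {z} → 1 ≤ 𝟙 z → L z
  1≤𝟙⇒L {z} _ with L? z
  ... | yes l = l
  1≤𝟙⇒L {z} () | no _

  -- (W ⋆ 𝟙) x counts the ways of writing x = w + l with w ∈ W, l ∈ L.
  record IsTile (W : List (Pt n)) : Set where
    field
      distinct : Unique W
      zero∈    : zeroPt ∈ W
      covers   : ∀ x → (W ⋆ 𝟙) x ≡ 1

  open IsTile

  isTiling⇒isTile : (V : FinSet n) → zeroPt ∈ elems V → IsTiling V L → IsTile (elems V)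
  isTiling⇒isTile V 0∈V (represent , uniquely) = record
    { distinct = unique V ; zero∈ = 0∈V ; covers = λ x → ≤-antisym (atMost x) (atLeast x) }
    where
      atMost : ∀ x → (elems V ⋆ 𝟙) x ≤ 1
      atMost x = sum-map≤1 (λ v → 𝟙 (x ⊝ v)) (unique V) (λ v → 𝟙≤1 (x ⊝ v))
        λ {v} {v′} v∈V v′∈V v≢v′ 1≤𝟙 1≤𝟙′ →
          v≢v′ (proj₁ (uniquely v v′ (x ⊝ v) (x ⊝ v′) v∈V v′∈V (1≤𝟙⇒L 1≤𝟙) (1≤𝟙⇒L 1≤𝟙′)
                                (trans (v⊕[x⊝v]≡x v x) (sym (v⊕[x⊝v]≡x v′ x)))))
      atLeast : ∀ x → 1 ≤ (elems V ⋆ 𝟙) x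
      atLeast x with represent x
      ... | v , l , v∈V , l∈L , x≡v⊕l =
        ≤-trans (L⇒1≤𝟙 (subst L (sym (trans (cong (_⊝ v) x≡v⊕l) ([v⊕l]⊝v≡l v l))) l∈L))
                (∈⇒≤sum-map (λ v → 𝟙 (x ⊝ v)) v∈V)

  ⋆𝟙-bounded : List (Pt n) → Set
  ⋆𝟙-bounded W′ = (∀ z → 1 ≤ (W′ ⋆ 𝟙) z) ⊎ (∀ z → (W′ ⋆ 𝟙) z ≤ 1)

  -- Σ_{b ∈ W} (W′ ⋆ 𝟙)(x − b) = ((W ⊛ W′) ⋆ 𝟙) x = |W′| = |W|,
  -- and all |W| terms lie on the same side of 1, so each of them (in particular b = 0) is 1.
  covers-by-counting : ∀ {W} W′ → IsTile W → length W′ ≡ length W → ⋆𝟙-bounded W′ →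
    ∀ x → (W′ ⋆ 𝟙) x ≡ 1
  covers-by-counting {W} W′ t |W′|≡|W| bounded x =
    trans (cong (W′ ⋆ 𝟙) (sym (⊝-zeroʳ x))) (at-zero bounded)
    where
      open ≡-Reasoning
      total : (W ⋆ W′ ⋆ 𝟙) x ≡ (W ⋆ const 1) x
      total = begin
        (W ⋆ W′ ⋆ 𝟙) x     ≡⟨ ⋆-comm W W′ 𝟙 x ⟩
        (W′ ⋆ W ⋆ 𝟙) x     ≡⟨ ⋆-congʳ W′ (covers t) x ⟩
        (W′ ⋆ const 1) x   ≡⟨ ⋆-const W′ 1 x ⟩
        length W′ * 1      ≡⟨ cong (_* 1) |W′|≡|W| ⟩
        length W * 1       ≡⟨ ⋆-const W 1 x ⟨
        (W ⋆ const 1) x    ∎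
      at-zero : ⋆𝟙-bounded W′ → (W′ ⋆ 𝟙) (x ⊝ zeroPt) ≡ 1
      at-zero (inj₁ 1≤) = sym (sum-map-≡⇒≡ W (λ _ → 1≤ _) (sym total) (zero∈ t))
      at-zero (inj₂ ≤1) = sum-map-≡⇒≡ W (λ _ → ≤1 _) total (zero∈ t)

  scale-isTile : ∀ {W} t → ¬ t ≡ 0ℤ → IsTile W → ⋆𝟙-bounded (map (scale t) W) →
    IsTile (map (scale t) W)
  scale-isTile {W} t t≢0 tile bounded = record
    { distinct = map⁺ (scale-injective t t≢0) (distinct tile)
    ; zero∈    = subst (_∈ map (scale t) W) (scale-zeroPt t) (∈-map⁺ (scale t) (zero∈ tile))
    ; covers   = covers-by-counting (map (scale t) W) tile (length-map (scale t) W) bounded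
    }

module ScaledTiles {n : ℕ} {L : Pt n → Set} (L? : ∀ x → Dec (L x)) where
  open Points
  open ModPrime using (prime∤⇒∤^)
  open ListSums using (sum-map≤1; 2≤sum-map)
  open Convolution {n}
  open Frobenius {n}
  open Tiles L?
  open IsTile
  open import Data.Nat as ℕ using (zero; suc; _+_; _*_; _≤_)
  open import Data.Nat.Properties using (n≢0⇒n>0; 1+n≰n; *-comm)
  open import Data.Nat.Divisibility using (_∣_; _∤_; divides; _∣0; ∣-refl)
  open import Data.Nat.Coprimality using (Coprime)
  open import Data.Nat.Primality using (Prime; ¬prime[0]; ¬prime[1])
  open import Data.Nat.Primality.Factorisation using (factorise; PrimeFactorisation)
  open PrimeFactorisation using (factors; isFactorisation; factorsPrime)
  open import Data.Nat.ListAction using (sum; product)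
  open import Data.Nat.ListAction.Properties using (∈⇒∣product)
  open import Data.Integer using (+_; -[1+_]; ∣_∣; 0ℤ; -1ℤ)
  open import Data.Integer.Properties using (pos-*; -1*i≡-i)
  import Data.Integer.Properties as ℤ
  open import Data.List using ([]; _∷_; map; length)
  open import Data.List.Properties using (length-map; map-∘)
  open import Data.List.Relation.Unary.All as All using (All; []; _∷_)
  open import Data.List.Relation.Unary.Any using (here)
  open import Data.Product using (_,_)
  open import Data.Empty using (⊥)
  open import Data.Sum using (inj₁; inj₂)
  open import Function using (const)
  open import Relation.Nullary using (¬_; contradiction)
  open import Relation.Binary.PropositionalEquality

  -- If z + a and z + a′ both lie in L for distinct a, a′ ∈ W, then z + a + a′ is covered twice.
  neg-isTile : ∀ {W} → IsTile W → IsTile (map (scale -1ℤ) W)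
  neg-isTile {W} tile = scale-isTile -1ℤ (λ ()) tile (inj₂ atMostOne)
    where
      atMostOne : ∀ z → (map (scale -1ℤ) W ⋆ 𝟙) z ≤ 1
      atMostOne z = subst (_≤ 1) (cong sum (map-∘ W))
        (sum-map≤1 (λ a → 𝟙 (z ⊝ scale -1ℤ a)) (distinct tile) (λ a → 𝟙≤1 _) clash)
        where
          clash : ∀ {a a′} → a ∈ W → a′ ∈ W → ¬ a ≡ a′ →
            1 ≤ 𝟙 (z ⊝ scale -1ℤ a) → 1 ≤ 𝟙 (z ⊝ scale -1ℤ a′) → ⊥
          clash {a} {a′} a∈W a′∈W a≢a′ 1≤𝟙 1≤𝟙′ =
            1+n≰n (subst (2 ≤_) (covers tile x)
                     (2≤sum-map (λ b → 𝟙 (x ⊝ b)) a∈W a′∈W a≢a′ at-a at-a′))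
            where
              x = z ⊝ scale -1ℤ a ⊝ scale -1ℤ a′
              at-a′ : 1 ≤ 𝟙 (x ⊝ a′)
              at-a′ = subst (λ y → 1 ≤ 𝟙 y) (sym ([y⊝-a]⊝a≡y (z ⊝ scale -1ℤ a) a′)) 1≤𝟙
              at-a : 1 ≤ 𝟙 (x ⊝ a)
              at-a = subst (λ y → 1 ≤ 𝟙 (y ⊝ a)) (sym (⊝-comm z (scale -1ℤ a) (scale -1ℤ a′)))
                       (subst (λ y → 1 ≤ 𝟙 y) (sym ([y⊝-a]⊝a≡y (z ⊝ scale -1ℤ a′) a)) 1≤𝟙′)

  power-⋆ : ∀ {W} → IsTile W → ∀ k x → (W ^ suc k ⋆ 𝟙) x ≡ length W ℕ.^ k
  power-⋆ {W} tile zero x = begin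
    (W ⊛ (zeroPt ∷ []) ⋆ 𝟙) x    ≡⟨ ⊛-⋆ W (zeroPt ∷ []) 𝟙 x ⟩
    (W ⋆ (zeroPt ∷ []) ⋆ 𝟙) x    ≡⟨ ⋆-congʳ W ([0]⋆ 𝟙) x ⟩
    (W ⋆ 𝟙) x                    ≡⟨ covers tile x ⟩
    1                            ∎
    where open ≡-Reasoning
  power-⋆ {W} tile (suc k) x = begin
    (W ⊛ W ^ suc k ⋆ 𝟙) x               ≡⟨ ⊛-⋆ W (W ^ suc k) 𝟙 x ⟩
    (W ⋆ W ^ suc k ⋆ 𝟙) x               ≡⟨ ⋆-congʳ W (power-⋆ tile k) x ⟩
    (W ⋆ const (length W ℕ.^ k)) x      ≡⟨ ⋆-const W (length W ℕ.^ k) x ⟩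
    length W * length W ℕ.^ k           ∎
    where open ≡-Reasoning

  prime-scale-isTile : ∀ {W p} → Prime p → p ∤ length W → IsTile W → IsTile (map (scale (+ p)) W)
  prime-scale-isTile {p = zero} pr = contradiction pr ¬prime[0]
  prime-scale-isTile {W} {p@(suc q)} pr p∤|W| tile = scale-isTile (+ p) (λ ()) tile (inj₁ atLeastOne)
    where
      atLeastOne : ∀ z → 1 ≤ (map (scale (+ p)) W ⋆ 𝟙) z
      atLeastOne z with frobenius pr W 𝟙 z
      ... | m , W^p≡ = n≢0⇒n>0 λ pW≡0 → prime∤⇒∤^ pr p∤|W| q (divides m (begin
        length W ℕ.^ q                      ≡⟨ power-⋆ tile q z ⟨
        (W ^ p ⋆ 𝟙) z                       ≡⟨ W^p≡ ⟩
        (map (scale (+ p)) W ⋆ 𝟙) z + p * m ≡⟨ cong (_+ p * m) pW≡0 ⟩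
        p * m                               ≡⟨ *-comm p m ⟩
        m * p                               ∎))
        where open ≡-Reasoning

  product-scale-isTile : ∀ {W} ps → All Prime ps → All (_∤ length W) ps → IsTile W →
    IsTile (map (scale (+ product ps)) W)
  product-scale-isTile {W} [] _ _ tile = subst IsTile (sym (map-scale-one W)) tile
  product-scale-isTile {W} (p ∷ ps) (p-prime ∷ ps-prime) (p∤|W| ∷ ps∤|W|) tile =
    subst IsTile (trans (map-scale-scale (+ p) (+ product ps) W)
                        (cong (λ t → map (scale t) W) (sym (pos-* p (product ps)))))
      (prime-scale-isTile p-prime (subst (p ∤_) (sym (length-map (scale (+ product ps)) W)) p∤|W|)
        (product-scale-isTile ps ps-prime ps∤|W| tile))

  zero-scale-isTile : ∀ {W} → length W ≡ 1 → IsTile W → IsTile (map (scale 0ℤ) W)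
  zero-scale-isTile {w ∷ []} _ tile with zero∈ tile
  ... | here 0≡w = subst (λ v → IsTile (v ∷ [])) (trans (sym 0≡w) (sym (scale-zero w))) tile

  coprime-scale-isTile : ∀ {W} a → Coprime ∣ a ∣ (length W) → IsTile W → IsTile (map (scale a) W)
  coprime-scale-isTile {W} (+ zero) coprime tile = zero-scale-isTile (coprime (length W ∣0 , ∣-refl)) tile
  coprime-scale-isTile {W} (+ suc m) coprime tile =
    subst (λ k → IsTile (map (scale (+ k)) W)) (sym (isFactorisation F))
      (product-scale-isTile (factors F) (factorsPrime F) (All.tabulate p∤|W|) tile)
    where
      F = factorise (suc m)
      p∤|W| : ∀ {p} → p ∈ factors F → p ∤ length W
      p∤|W| {p} p∈F p∣|W| = ¬prime[1] (subst Prime (coprime (p∣1+m , p∣|W|)) p-prime)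
        where
          p-prime = All.lookup (factorsPrime F) p∈F
          p∣1+m = subst (p ∣_) (sym (isFactorisation F)) (∈⇒∣product p∈F)
  coprime-scale-isTile {W} -[1+ m ] coprime tile =
    subst IsTile negate-then-scale
      (coprime-scale-isTile (+ suc m) (subst (Coprime (suc m)) (sym (length-map (scale -1ℤ) W)) coprime)
        (neg-isTile tile))
    where
      negate-then-scale : map (scale (+ suc m)) (map (scale -1ℤ) W) ≡ map (scale -[1+ m ]) W
      negate-then-scale = trans (map-scale-scale (+ suc m) -1ℤ W)
        (cong (λ t → map (scale t) W) (trans (ℤ.*-comm (+ suc m) -1ℤ) (-1*i≡-i (+ suc m))))

module Trace {n : ℕ} {L : Pt n → Set} (L? : ∀ x → Dec (L x)) where
  open Points
  open Convolution {n}
  open Tiles L?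
  open import Data.Integer using (+_; 1ℤ; _+_; _*_)
  open import Data.Integer.Properties using (+-identityˡ; +-assoc; *-identityʳ; *-zeroʳ; *-distribˡ-+)
  open import Data.List using ([]; _∷_; _++_; map)
  open import Data.List.Properties using (++-identityʳ)
  open import Data.Product using (_,_)
  open import Relation.Nullary using (yes; no)
  open import Relation.Binary.PropositionalEquality

  T-++ : ∀ (A B : Laurent n) → T L? (A ++ B) ≡ T L? A + T L? B
  T-++ [] B = sym (+-identityˡ _)
  T-++ ((c , e) ∷ A) B with L? e
  ... | yes _ = trans (cong (_+_ c) (T-++ A B)) (sym (+-assoc c _ _))
  ... | no  _ = T-++ A B

  ·-cons : ∀ c e (P R : Laurent n) → ((c , e) ∷ P) · R ≡ ((c , e) ∷ []) · R ++ P · R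
  ·-cons c e P R = cong (_++ P · R) (sym (++-identityʳ _))

  T-monomial·Q : ∀ c e a vs →
    T L? (((c , e) ∷ []) · substPow a (map (λ v → (1ℤ , ⊖ v)) vs)) ≡
    c * + (map (scale a) vs ⋆ 𝟙) e
  T-monomial·Q c e a [] = sym (*-zeroʳ c)
  T-monomial·Q c e a (v ∷ vs) rewrite scale-⊖ a v with L? (e ⊝ scale a v)
  ... | yes _ = trans (cong (_+_ (c * 1ℤ)) (T-monomial·Q c e a vs)) (sym (*-distribˡ-+ c 1ℤ _))
  ... | no  _ = T-monomial·Q c e a vs

  T-·-substPow-Q : ∀ (V : FinSet n) a → (∀ e → (map (scale a) (elems V) ⋆ 𝟙) e ≡ 1) →
    ∀ P → T L? (P · substPow a (Q V)) ≡ evalOne P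
  T-·-substPow-Q V a covers [] = refl
  T-·-substPow-Q V a covers ((c , e) ∷ P) = begin
    T L? (((c , e) ∷ P) · S)                            ≡⟨ cong (T L?) (·-cons c e P S) ⟩
    T L? (((c , e) ∷ []) · S ++ P · S)                  ≡⟨ T-++ (((c , e) ∷ []) · S) (P · S) ⟩
    T L? (((c , e) ∷ []) · S) + T L? (P · S)            ≡⟨ cong₂ _+_ (T-monomial·Q c e a (elems V))
                                                                    (T-·-substPow-Q V a covers P) ⟩
    c * + (map (scale a) (elems V) ⋆ 𝟙) e + evalOne P  ≡⟨ cong (λ k → c * + k + evalOne P) (covers e) ⟩
    c * 1ℤ + evalOne P                                  ≡⟨ cong (_+ evalOne P) (*-identityʳ c) ⟩
    c + evalOne P                                       ∎
    where
      open ≡-Reasoning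
      S = substPow a (Q V)

theorem8 : ∀ (n : ℕ) (V : FinSet n) (L : Pt n → Set) (L? : ∀ x → Dec (L x)) →
    zeroPt ∈ elems V →
    IsTiling V L →
    (a : ℤ) → Coprime ∣ a ∣ (card V) →
    (P : Laurent n) →
    T L? (P · substPow a (Q V)) ≡ evalOne P
theorem8 n V L L? 0∈V tiling a coprime =
  T-·-substPow-Q V a (IsTile.covers (coprime-scale-isTile a coprime (isTiling⇒isTile V 0∈V tiling)))
  where
    open Tiles L?
    open ScaledTiles L?
    open Trace L?
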